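{- A finite universe of separations $\vec U$ has a graphic implementation if and only if $\vec U$ is distributive and the set $\mathrm{Small}(\vec U)$ of small elements of $\vec U$, with the order induced from $\vec U$, is a boolean algebra whose maximal element is degenerate in $\vec U$.
   Context: A separation system is a poset with an order-reversing involution $\vec s\mapsto\vec s^{\,*}$; a universe of separations is a separation system which is a lattice, with join $\vee$ and meet $\wedge$; it is distributive if this lattice is distributive. An element $\vec s$ is small if $\vec s\le\vec s^{\,*}$ and degenerate if $\vec s=\vec s^{\,*}$. An isomorphism of universes is a bijection commuting with involutions, joins and meets whose inverse also does so. For a set $V$, $\mathcal{U}(V)$ is the universe of all pairs $(A,B)$ of subsets of $V$ with $A\cup B=V$, with involution $(A,B)^*=(B,A)$, order $(A,B)\le(C,D)$ iff $A\subseteq C$ and $D\subseteq B$, join $(A\cup C,B\cap D)$ and meet $(A\cap C,B\cup D)$. For an undirected graph $G=(V,E)$, $\mathcal{U}(G)$ is the sub-universe of $\mathcal{U}(V)$ consisting of all $(A,B)$ such that $G$ has no edge between a vertex of $A\setminus B$ and a vertex of $B\setminus A$. A universe $\vec U$ has a graphic implementation if there is a graph $G$ such that $\mathcal{U}(G)$ is isomorphic (as a universe) to $\vec U$ itself. -}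

module Defs where

open import Level using (0ℓ)
open import Data.Nat using (ℕ)
open import Data.Fin using (Fin)
open import Data.Fin.Subset using (Subset; _∈_; _∉_; _∪_; _∩_; ⊤)
open import Data.Product using (Σ; ∃; ∃-syntax; _×_; _,_; proj₁; proj₂)
open import Relation.Nullary using (¬_)
open import Relation.Binary.Core using (Rel)
open import Relation.Binary.Structures using (IsPartialOrder)
open import Relation.Binary.PropositionalEquality using (_≡_)
open import Relation.Binary.Lattice.Structures using (IsLattice; IsDistributiveLattice; IsBooleanAlgebra)
open import Function.Bundles using (_↔_)
open import Function.Definitions using (Injective)
open import Algebra.Core using (Op₁; Op₂)

record Universe : Set₁ where
  infixl 30 _*
  infixr 6 _∨_
  infixr 7 _∧_
  field
    Carrier   : Set
    _≤_       : Rel Carrier 0ℓ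
    _*        : Carrier → Carrier
    _∨_       : Carrier → Carrier → Carrier
    _∧_       : Carrier → Carrier → Carrier
    isLattice : IsLattice _≡_ _≤_ _∨_ _∧_
    *-invol   : ∀ s → (s *) * ≡ s
    *-antitone : ∀ {s t} → s ≤ t → (t *) ≤ (s *)

  isPartialOrder : IsPartialOrder _≡_ _≤_
  isPartialOrder = IsLattice.isPartialOrder isLattice

  IsSmall : Carrier → Set
  IsSmall s = s ≤ (s *)

  IsDegenerate : Carrier → Set
  IsDegenerate s = s ≡ s *

  Small : Set
  Small = Σ Carrier IsSmall

  _≈S_ : Rel Small 0ℓ
  x ≈S y = proj₁ x ≡ proj₁ y

  _≤S_ : Rel Small 0ℓ
  x ≤S y = proj₁ x ≤ proj₁ y

open Universe

Finite : Universe → Set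
Finite U = ∃[ n ] (Carrier U ↔ Fin n)

Distributive : Universe → Set
Distributive U = IsDistributiveLattice _≡_ (_≤_ U) (_∨_ U) (_∧_ U)

SmallBooleanWithDegenerateTop : Universe → Set
SmallBooleanWithDegenerateTop U =
  Σ (Op₂ (Small U)) λ _∨'_ →
  Σ (Op₂ (Small U)) λ _∧'_ →
  Σ (Op₁ (Small U)) λ ¬'_ →
  Σ (Small U) λ ⊤' →
  Σ (Small U) λ ⊥' →
    IsBooleanAlgebra (_≈S_ U) (_≤S_ U) _∨'_ _∧'_ ¬'_ ⊤' ⊥'
    × IsDegenerate U (proj₁ ⊤')

record Graph : Set₁ where
  field
    m      : ℕ
    Adj    : Fin m → Fin m → Set
    sym    : ∀ {u v} → Adj u v → Adj v u
    irrefl : ∀ {u} → ¬ Adj u u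

-- Elements of U(V) for V = Fin m: pairs (A , B) of subsets with A ∪ B = V.
Sep : ℕ → Set
Sep m = Subset m × Subset m

swapSep : ∀ {m} → Sep m → Sep m
swapSep (A , B) = (B , A)

joinSep : ∀ {m} → Sep m → Sep m → Sep m
joinSep (A , B) (C , D) = (A ∪ C , B ∩ D)

meetSep : ∀ {m} → Sep m → Sep m → Sep m
meetSep (A , B) (C , D) = (A ∩ C , B ∪ D)

InUG : (G : Graph) → Sep (Graph.m G) → Set
InUG G (A , B) =
  (A ∪ B ≡ ⊤) ×
  (∀ u v → u ∈ A → u ∉ B → v ∈ B → v ∉ A → ¬ Graph.Adj G u v)

-- An isomorphism of universes from U onto U(G): an injective map
-- f : U → U(V) whose image is exactly U(G), commuting with the involution,
-- joins and meets. (Its inverse then automatically commutes with them too.)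
record IsoToUG (U : Universe) (G : Graph) : Set where
  field
    f        : Carrier U → Sep (Graph.m G)
    injective : Injective _≡_ _≡_ f
    into     : ∀ x → InUG G (f x)
    onto     : ∀ s → InUG G s → ∃[ x ] (f x ≡ s)
    pres-*   : ∀ x → f (_* U x) ≡ swapSep (f x)
    pres-∨   : ∀ x y → f (_∨_ U x y) ≡ joinSep (f x) (f y)
    pres-∧   : ∀ x y → f (_∧_ U x y) ≡ meetSep (f x) (f y)

HasGraphicImplementation : Universe → Set₁
HasGraphicImplementation U = Σ Graph λ G → IsoToUG U G

-- The small elements of U(G) are the separations (A , V), a copy of the power
-- set of V whose top (V , V) is degenerate, and U(G) is a sublattice of the
-- distributive lattice of pairs of subsets; an isomorphism transports both facts.
--
-- Conversely, let δ be the degenerate top of Small(U); then Small(U) = ↓δ, its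
-- bottom is the bottom of U, and its atoms are join-prime. Every atom lies below
-- x or below x*, since x ∧ x* is small and so below δ ≤ (x ∧ x*)*. Represent x by
-- the pair (atoms below x, atoms below x*): this is a homomorphism, and it is
-- injective because ↓δ is atomistic, which determines x ∧ δ, dually x ∨ δ, and
-- hence x by distributivity. Taking the atoms as vertices, adjacent when no
-- separation has one inside and the other inside its inverse, the image is
-- exactly U(G).

module Submission where

open import Defs
open import Level using (0ℓ)
open import Algebra.Core using (Op₁; Op₂)
open import Data.Nat using (ℕ; zero; suc)
open import Data.Product using (∃; ∃-syntax; _×_; _,_; proj₁; proj₂)
open import Data.Sum using (_⊎_; inj₁; inj₂; [_,_]′; map₂)
import Data.Sum
open import Data.Empty using (⊥-elim)
open import Data.Fin using (Fin)
open import Data.Fin.Properties using (any?; all?; inj⇒≟)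
open import Data.Fin.Subset using (Subset; _∈_; _∉_; _∪_; _∩_; ⊤; ⊥; ∁)
open import Data.Fin.Subset.Properties
  using (_∈?_; ⊆-antisym; ∈⊤; x∈p∪q⁻; x∈p∪q⁺; x∈p∩q⁻; x∈p∩q⁺; ∪-zeroʳ; ∩-identityˡ; ∪-identityˡ;
         ∩-idem; ∪-idem; ∩-inverseʳ; ∪-inverseʳ; ∩-distribˡ-∪; ∪-distribˡ-∩)
open import Data.List using (List; _∷_; []; map; allFin; filter; length; lookup)
open import Data.List.Membership.Propositional using () renaming (_∈_ to _∈ˡ_)
open import Data.List.Membership.Propositional.Properties using (∈-allFin; ∈-map⁺; ∈-filter⁺; ∈-lookup)
open import Data.List.Relation.Unary.Any using (here; there; index)
open import Data.List.Relation.Unary.Any.Properties using (lookup-index)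
import Data.List.Relation.Unary.All as All
open import Data.List.Relation.Unary.All.Properties using (all-filter)
open import Data.List.Relation.Unary.AllPairs using (_∷_)
open import Data.List.Relation.Unary.Unique.Propositional using (Unique)
open import Data.List.Relation.Unary.Unique.Propositional.Properties using (allFin⁺; filter⁺)
open import Data.Vec using (tabulate)
open import Data.Vec.Properties using (lookup∘tabulate; []=⇒lookup; lookup⇒[]=)
import Data.Vec.Functional as Vector
open import Function using (_∘_)
open import Function.Bundles using (_↔_; Inverse; _⇔_; mk⇔)
open import Function.Definitions using (Injective)
open import Function.Properties.Inverse using (↔⇒↣)
open import Relation.Binary.Bundles using (Poset)
open import Relation.Binary.Core using (Rel)
open import Relation.Binary.Definitions using (Maximum; Minimum; DecidableEquality)
import Relation.Binary.Construct.On as On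
open import Relation.Binary.Lattice.Structures
  using (IsLattice; IsDistributiveLattice; IsBooleanAlgebra)
import Relation.Binary.Reasoning.PartialOrder as ≤-Reasoning
open import Relation.Binary.PropositionalEquality as ≡
  using (_≡_; _≢_; refl; cong; cong₂; subst; module ≡-Reasoning)
open import Relation.Nullary using (¬_; Dec; yes; no; does)
open import Relation.Nullary.Decidable
  using (map′; _×-dec_; _⊎-dec_; _→-dec_; ¬?; toSum; dec-true; decidable-stable)
open import Relation.Unary using (Pred; Decidable)

lookup-injective : ∀ {A : Set} {xs : List A} → Unique xs →
                   Injective _≡_ _≡_ (lookup xs)
lookup-injective {xs = x ∷ xs} _ {Fin.zero} {Fin.zero} _ = refl
lookup-injective {xs = x ∷ xs} (x∉xs ∷ _) {Fin.zero} {Fin.suc j} eq =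
  ⊥-elim (All.lookup x∉xs (∈-lookup j) eq)
lookup-injective {xs = x ∷ xs} (x∉xs ∷ _) {Fin.suc i} {Fin.zero} eq =
  ⊥-elim (All.lookup x∉xs (∈-lookup i) (≡.sym eq))
lookup-injective {xs = x ∷ xs} (_ ∷ unique) {Fin.suc i} {Fin.suc j} eq =
  cong Fin.suc (lookup-injective unique eq)

subset : ∀ {n} {P : Pred (Fin n) 0ℓ} → Decidable P → Subset n
subset P? = tabulate (does ∘ P?)

∈-subset⁺ : ∀ {n} {P : Pred (Fin n) 0ℓ} (P? : Decidable P) {v} → P v → v ∈ subset P?
∈-subset⁺ P? {v} p = lookup⇒[]= v _ (≡.trans (lookup∘tabulate (does ∘ P?) v) (dec-true (P? v) p))

∈-subset⁻ : ∀ {n} {P : Pred (Fin n) 0ℓ} (P? : Decidable P) {v} → v ∈ subset P? → P v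
∈-subset⁻ P? {v} v∈P with P? v | ≡.trans (≡.sym (lookup∘tabulate (does ∘ P?) v)) ([]=⇒lookup v∈P)
... | yes p | _  = p
... | no _  | ()

record Enumeration {A : Set} (P : Pred A 0ℓ) : Set where
  field
    size       : ℕ
    element    : Fin size → A
    injective  : Injective _≡_ _≡_ element
    sound      : ∀ i → P (element i)
    complete   : ∀ {a} → P a → ∃[ i ] element i ≡ a

module FiniteType {A : Set} {n : ℕ} (A↔Fin : A ↔ Fin n) where

  open Inverse A↔Fin using (to; from; strictlyInverseˡ; strictlyInverseʳ)

  infix 4 _≟_
  _≟_ : DecidableEquality A
  _≟_ = inj⇒≟ (↔⇒↣ A↔Fin)

  ∀? : {P : Pred A 0ℓ} → Decidable P → Dec (∀ a → P a)
  ∀? {P} P? = map′ (λ ∀P a → subst P (strictlyInverseʳ a) (∀P (to a))) (λ ∀P i → ∀P (from i))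
                   (all? (P? ∘ from))

  ∃? : {P : Pred A 0ℓ} → Decidable P → Dec (∃ P)
  ∃? {P} P? = map′ (λ (i , p) → from i , p)
                   (λ (a , p) → to a , subst P (≡.sym (strictlyInverseʳ a)) p)
                   (any? (P? ∘ from))

  elements : List A
  elements = map from (allFin n)

  ∈-elements : ∀ a → a ∈ˡ elements
  ∈-elements a = subst (_∈ˡ elements) (strictlyInverseʳ a) (∈-map⁺ from (∈-allFin (to a)))

  enumerate : {P : Pred A 0ℓ} → Decidable P → Enumeration P
  enumerate {P} P? = record
    { size      = length indices
    ; element   = element
    ; injective = λ eq → lookup-injective (filter⁺ (P? ∘ from) (allFin⁺ n)) (from-injective eq)
    ; sound     = λ i → All.lookup (all-filter (P? ∘ from) (allFin n)) (∈-lookup i)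
    ; complete  = λ {a} p → complete a (∈-filter⁺ (P? ∘ from) (∈-allFin (to a))
                                         (subst P (≡.sym (strictlyInverseʳ a)) p)) }
    where
      indices : List (Fin n)
      indices = filter (P? ∘ from) (allFin n)

      element : Fin (length indices) → A
      element i = from (lookup indices i)

      from-injective : Injective _≡_ _≡_ from
      from-injective {i} {j} eq =
        ≡.trans (≡.sym (strictlyInverseˡ i)) (≡.trans (cong to eq) (strictlyInverseˡ j))

      complete : ∀ a → to a ∈ˡ indices → ∃[ i ] element i ≡ a
      complete a mem =
        index mem , ≡.trans (cong from (≡.sym (lookup-index mem))) (strictlyInverseʳ a)

module _ {a ℓ₁ ℓ₂} {A : Set a} {_≈_ : Rel A ℓ₁} {_≤_ : Rel A ℓ₂}
         {_∨_ _∧_ : Op₂ A} {¬_ : Op₁ A} {top bot : A} where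

  complemented⇒isBooleanAlgebra :
    IsDistributiveLattice _≈_ _≤_ _∨_ _∧_ → Maximum _≤_ top → Minimum _≤_ bot →
    (∀ x → (x ∧ (¬ x)) ≤ bot) → (∀ x → top ≤ (x ∨ (¬ x))) →
    IsBooleanAlgebra _≈_ _≤_ _∨_ _∧_ ¬_ top bot
  complemented⇒isBooleanAlgebra isDL maximum minimum x∧¬x≤bot top≤x∨¬x = record
    { isHeytingAlgebra = record
      { isBoundedLattice = record { isLattice = isLattice ; maximum = maximum ; minimum = minimum }
      ; exponential = λ w x y → curry w x y , uncurry w x y } }
    where
      open IsDistributiveLattice isDL renaming (refl to ≤-refl; trans to ≤-trans)

      poset : Poset a ℓ₁ ℓ₂
      poset = record { isPartialOrder = isPartialOrder }

      open ≤-Reasoning poset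

      curry : ∀ w x y → (w ∧ x) ≤ y → w ≤ ((¬ x) ∨ y)
      curry w x y w∧x≤y = begin
        w                         ≤⟨ ∧-greatest ≤-refl (≤-trans (maximum w) (top≤x∨¬x x)) ⟩
        w ∧ (x ∨ (¬ x))           ≈⟨ ∧-distribˡ-∨ w x (¬ x) ⟩
        (w ∧ x) ∨ (w ∧ (¬ x))     ≤⟨ ∨-least (≤-trans w∧x≤y (y≤x∨y (¬ x) y))
                                             (≤-trans (x∧y≤y w (¬ x)) (x≤x∨y (¬ x) y)) ⟩
        (¬ x) ∨ y                 ∎

      uncurry : ∀ w x y → w ≤ ((¬ x) ∨ y) → (w ∧ x) ≤ y
      uncurry w x y w≤¬x∨y = begin
        w ∧ x                     ≤⟨ ∧-greatest (x∧y≤y w x) (≤-trans (x∧y≤x w x) w≤¬x∨y) ⟩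
        x ∧ ((¬ x) ∨ y)           ≈⟨ ∧-distribˡ-∨ x (¬ x) y ⟩
        (x ∧ (¬ x)) ∨ (x ∧ y)     ≤⟨ ∨-least (≤-trans (x∧¬x≤bot x) (minimum y)) (x∧y≤y x y) ⟩
        y                         ∎

module UniverseProperties (U : Universe) where

  open Universe U public
  open IsLattice isLattice public
    using (x≤x∨y; y≤x∨y; ∨-least; x∧y≤x; x∧y≤y; ∧-greatest; antisym; reflexive)
    renaming (refl to ≤-refl; trans to ≤-trans)

  poset : Poset 0ℓ 0ℓ 0ℓ
  poset = record { isPartialOrder = isPartialOrder }

  ≤⇒∨≡ : ∀ {x y} → x ≤ y → x ∨ y ≡ y
  ≤⇒∨≡ {x} {y} x≤y = antisym (∨-least x≤y ≤-refl) (y≤x∨y x y)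

  ∨≡⇒≤ : ∀ {x y} → x ∨ y ≡ y → x ≤ y
  ∨≡⇒≤ {x} eq = subst (x ≤_) eq (x≤x∨y x _)

  ≤*-swap : ∀ {x y} → x ≤ y * → y ≤ x *
  ≤*-swap {x} {y} x≤y* = subst (_≤ x *) (*-invol y) (*-antitone x≤y*)

  *≤-swap : ∀ {x y} → x * ≤ y → y * ≤ x
  *≤-swap {x} {y} x*≤y = subst (y * ≤_) (*-invol x) (*-antitone x*≤y)

  *-∨ : ∀ x y → (x ∨ y) * ≡ x * ∧ y *
  *-∨ x y = antisym (∧-greatest (*-antitone (x≤x∨y x y)) (*-antitone (y≤x∨y x y)))
                    (≤*-swap (∨-least (≤*-swap (x∧y≤x _ _)) (≤*-swap (x∧y≤y _ _))))

  *-∧ : ∀ x y → (x ∧ y) * ≡ x * ∨ y *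
  *-∧ x y = antisym (*≤-swap (∧-greatest (*≤-swap (x≤x∨y _ _)) (*≤-swap (y≤x∨y _ _))))
                    (∨-least (*-antitone (x∧y≤x x y)) (*-antitone (x∧y≤y x y)))

  module SmallSublattice
    (∨-small : ∀ {x y} → IsSmall x → IsSmall y → IsSmall (x ∨ y))
    (∧-small : ∀ {x y} → IsSmall x → IsSmall y → IsSmall (x ∧ y)) where

    _∨ₛ_ : Op₂ Small
    (x , x-small) ∨ₛ (y , y-small) = x ∨ y , ∨-small x-small y-small

    _∧ₛ_ : Op₂ Small
    (x , x-small) ∧ₛ (y , y-small) = x ∧ y , ∧-small x-small y-small

    isDistributiveLattice : Distributive U → IsDistributiveLattice _≈S_ _≤S_ _∨ₛ_ _∧ₛ_
    isDistributiveLattice distributive = record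
      { isLattice = record
        { isPartialOrder = On.isPartialOrder proj₁ isPartialOrder
        ; supremum = λ x y → x≤x∨y _ _ , y≤x∨y _ _ , λ _ → ∨-least
        ; infimum = λ x y → x∧y≤x _ _ , x∧y≤y _ _ , λ _ → ∧-greatest }
      ; ∧-distribˡ-∨ = λ x y z →
          IsDistributiveLattice.∧-distribˡ-∨ distributive (proj₁ x) (proj₁ y) (proj₁ z) }

module FiniteUniverse (U : Universe) (finite : Finite U) where

  open UniverseProperties U
  open FiniteType (proj₂ finite) public

  infix 4 _≤?_
  _≤?_ : ∀ x y → Dec (x ≤ y)
  x ≤? y = map′ ∨≡⇒≤ ≤⇒∨≡ (x ∨ y ≟ y)

  minimal-in : {P : Pred Carrier 0ℓ} → Decidable P → ∀ bs {c} → P c →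
               ∃[ m ] (m ≤ c × P m × (∀ {b} → b ∈ˡ bs → P b → b ≤ m → b ≡ m))
  minimal-in P? [] {c} Pc = c , ≤-refl , Pc , λ ()
  minimal-in P? (b ∷ bs) {c} Pc with P? b ×-dec b ≤? c
  ... | yes (Pb , b≤c) =
    let m , m≤b , Pm , minimal = minimal-in P? bs Pb in
    m , ≤-trans m≤b b≤c , Pm ,
    λ { (here refl) _ b≤m → antisym b≤m m≤b ; (there b′∈bs) → minimal b′∈bs }
  ... | no ¬Pb×b≤c =
    let m , m≤c , Pm , minimal = minimal-in P? bs Pc in
    m , m≤c , Pm ,
    λ { (here refl) Pb b≤m → ⊥-elim (¬Pb×b≤c (Pb , ≤-trans b≤m m≤c))
      ; (there b′∈bs) → minimal b′∈bs }

  minimal-below : {P : Pred Carrier 0ℓ} → Decidable P → ∀ {c} → P c →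
                  ∃[ m ] (m ≤ c × P m × (∀ {b} → P b → b ≤ m → b ≡ m))
  minimal-below P? Pc =
    let m , m≤c , Pm , minimal = minimal-in P? elements Pc in
    m , m≤c , Pm , λ Pb b≤m → minimal (∈-elements _) Pb b≤m

module Joins (U : Universe) (𝟘 : Universe.Carrier U) (𝟘-least : ∀ x → Universe._≤_ U 𝟘 x) where

  open UniverseProperties U

  𝟙 : Carrier
  𝟙 = 𝟘 *

  𝟙-greatest : ∀ x → x ≤ 𝟙
  𝟙-greatest x = ≤*-swap (𝟘-least (x *))

  ⋁ ⋀ : ∀ {k} → (Fin k → Carrier) → Carrier
  ⋁ = Vector.foldr _∨_ 𝟘
  ⋀ = Vector.foldr _∧_ 𝟙

  ⋁-upper : ∀ {k} (g : Fin k → Carrier) i → g i ≤ ⋁ g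
  ⋁-upper g Fin.zero    = x≤x∨y _ _
  ⋁-upper g (Fin.suc i) = ≤-trans (⋁-upper (g ∘ Fin.suc) i) (y≤x∨y _ _)

  ⋁-least : ∀ {k} (g : Fin k → Carrier) {y} → (∀ i → g i ≤ y) → ⋁ g ≤ y
  ⋁-least {zero}  g {y} _ = 𝟘-least y
  ⋁-least {suc k} g g≤y   = ∨-least (g≤y Fin.zero) (⋁-least (g ∘ Fin.suc) (g≤y ∘ Fin.suc))

  ⋀-lower : ∀ {k} (g : Fin k → Carrier) i → ⋀ g ≤ g i
  ⋀-lower g Fin.zero    = x∧y≤x _ _
  ⋀-lower g (Fin.suc i) = ≤-trans (x∧y≤y _ _) (⋀-lower (g ∘ Fin.suc) i)

  ⋀-greatest : ∀ {k} (g : Fin k → Carrier) {y} → (∀ i → y ≤ g i) → y ≤ ⋀ g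
  ⋀-greatest {zero}  g {y} _ = 𝟙-greatest y
  ⋀-greatest {suc k} g y≤g   = ∧-greatest (y≤g Fin.zero) (⋀-greatest (g ∘ Fin.suc) (y≤g ∘ Fin.suc))

  *-⋀ : ∀ {k} (g : Fin k → Carrier) → ⋀ g * ≡ ⋁ (λ i → g i *)
  *-⋀ {zero}  g = *-invol 𝟘
  *-⋀ {suc k} g = ≡.trans (*-∧ _ _) (cong (g Fin.zero * ∨_) (*-⋀ (g ∘ Fin.suc)))

  JoinPrime : Pred Carrier 0ℓ
  JoinPrime a = ¬ (a ≤ 𝟘) × (∀ x y → a ≤ (x ∨ y) → a ≤ x ⊎ a ≤ y)

  ⋁-prime : ∀ {k} (g : Fin k → Carrier) {a} → JoinPrime a → a ≤ ⋁ g → ∃[ i ] a ≤ g i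
  ⋁-prime {zero}  g (a≰𝟘 , _) a≤𝟘 = ⊥-elim (a≰𝟘 a≤𝟘)
  ⋁-prime {suc k} g a-prime a≤⋁g with proj₂ a-prime _ _ a≤⋁g
  ... | inj₁ a≤g₀   = Fin.zero , a≤g₀
  ... | inj₂ a≤⋁g′ = let i , a≤gi = ⋁-prime (g ∘ Fin.suc) a-prime a≤⋁g′ in Fin.suc i , a≤gi

  when : ∀ {Q : Set} → Dec Q → Carrier → Carrier
  when (yes _) c = c
  when (no _)  _ = 𝟘

  infix 30 ⋁[_]_
  ⋁[_]_ : ∀ {k} {Q : Pred (Fin k) 0ℓ} → Decidable Q → (Fin k → Carrier) → Carrier
  ⋁[ Q? ] g = ⋁ (λ i → when (Q? i) (g i))

  ⋁[]-upper : ∀ {k} {Q : Pred (Fin k) 0ℓ} (Q? : Decidable Q) (g : Fin k → Carrier) {i} →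
              Q i → g i ≤ ⋁[ Q? ] g
  ⋁[]-upper Q? g {i} Qi with Q? i | ⋁-upper (λ j → when (Q? j) (g j)) i
  ... | yes _  | gi≤⋁ = gi≤⋁
  ... | no ¬Qi | _    = ⊥-elim (¬Qi Qi)

  ⋁[]-least : ∀ {k} {Q : Pred (Fin k) 0ℓ} (Q? : Decidable Q) (g : Fin k → Carrier) {y} →
              (∀ i → Q i → g i ≤ y) → ⋁[ Q? ] g ≤ y
  ⋁[]-least Q? g {y} g≤y = ⋁-least _ λ i → when-≤ (Q? i) (g≤y i)
    where
      when-≤ : ∀ {Q : Set} (Q? : Dec Q) {c} → (Q → c ≤ y) → when Q? c ≤ y
      when-≤ (yes q) c≤y = c≤y q
      when-≤ (no _)  _   = 𝟘-least y

  ⋁[]-prime : ∀ {k} {Q : Pred (Fin k) 0ℓ} (Q? : Decidable Q) (g : Fin k → Carrier) {a} →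
              JoinPrime a → a ≤ ⋁[ Q? ] g → ∃[ i ] (Q i × a ≤ g i)
  ⋁[]-prime Q? g {a} a-prime a≤⋁ =
    let i , a≤when = ⋁-prime _ a-prime a≤⋁ in i , ≤-when (Q? i) a≤when
    where
      ≤-when : ∀ {Q : Set} (Q? : Dec Q) {c} → a ≤ when Q? c → Q × a ≤ c
      ≤-when (yes q) a≤c = q , a≤c
      ≤-when (no _)  a≤𝟘 = ⊥-elim (proj₁ a-prime a≤𝟘)

module GraphicUniverse (U : Universe) (G : Graph) (iso : IsoToUG U G) where

  open UniverseProperties U
  open IsoToUG iso
  open ≡-Reasoning

  private
    V = Graph.m G

  ≤⇒f∨≡ : ∀ {x y} → x ≤ y → joinSep (f x) (f y) ≡ f y
  ≤⇒f∨≡ {x} {y} x≤y = ≡.trans (≡.sym (pres-∨ x y)) (cong f (≤⇒∨≡ x≤y))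

  f∨≡⇒≤ : ∀ {x y} → joinSep (f x) (f y) ≡ f y → x ≤ y
  f∨≡⇒≤ {x} {y} eq = ∨≡⇒≤ (injective (≡.trans (pres-∨ x y) eq))

  distributive : Distributive U
  distributive = record
    { isLattice = isLattice
    ; ∧-distribˡ-∨ = λ x y z → injective (begin
        f (x ∧ (y ∨ z))                                ≡⟨ pres-∧ x (y ∨ z) ⟩
        meetSep (f x) (f (y ∨ z))                      ≡⟨ cong (meetSep (f x)) (pres-∨ y z) ⟩
        meetSep (f x) (joinSep (f y) (f z))            ≡⟨ sep-distrib (f x) (f y) (f z) ⟩
        joinSep (meetSep (f x) (f y)) (meetSep (f x) (f z))
                                                       ≡⟨ ≡.sym (cong₂ joinSep (pres-∧ x y) (pres-∧ x z)) ⟩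
        joinSep (f (x ∧ y)) (f (x ∧ z))                ≡⟨ ≡.sym (pres-∨ (x ∧ y) (x ∧ z)) ⟩
        f ((x ∧ y) ∨ (x ∧ z))                          ∎) }
    where
      sep-distrib : (p q r : Sep V) → meetSep p (joinSep q r) ≡ joinSep (meetSep p q) (meetSep p r)
      sep-distrib (A , B) (C , D) (E , F) = cong₂ _,_ (∩-distribˡ-∪ A C E) (∪-distribˡ-∩ B D F)

  small⇒f≡ : ∀ {x} → IsSmall x → f x ≡ (proj₁ (f x) , ⊤)
  small⇒f≡ {x} x≤x* = cong (proj₁ (f x) ,_) (begin
    proj₂ (f x)                       ≡⟨ cong proj₁ (≡.sym (pres-* x)) ⟩
    proj₁ (f (x *))                   ≡⟨ cong proj₁ (≡.sym (≤⇒f∨≡ x≤x*)) ⟩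
    proj₁ (f x) ∪ proj₁ (f (x *))     ≡⟨ cong (λ s → proj₁ (f x) ∪ proj₁ s) (pres-* x) ⟩
    proj₁ (f x) ∪ proj₂ (f x)         ≡⟨ proj₁ (into x) ⟩
    ⊤                                 ∎)

  f≡⇒small : ∀ {x A} → f x ≡ (A , ⊤) → IsSmall x
  f≡⇒small {x} {A} fx≡ = f∨≡⇒≤ (begin
    joinSep (f x) (f (x *))           ≡⟨ cong (joinSep (f x)) (pres-* x) ⟩
    joinSep (f x) (swapSep (f x))     ≡⟨ cong (λ s → joinSep s (swapSep s)) fx≡ ⟩
    (A ∪ ⊤ , ⊤ ∩ A)                   ≡⟨ cong₂ _,_ (∪-zeroʳ A) (∩-identityˡ A) ⟩
    (⊤ , A)                           ≡⟨ cong swapSep (≡.sym fx≡) ⟩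
    swapSep (f x)                     ≡⟨ ≡.sym (pres-* x) ⟩
    f (x *)                           ∎)

  ∨-small : ∀ {x y} → IsSmall x → IsSmall y → IsSmall (x ∨ y)
  ∨-small {x} {y} x-small y-small = f≡⇒small (begin
    f (x ∨ y)                                 ≡⟨ pres-∨ x y ⟩
    joinSep (f x) (f y)                       ≡⟨ cong₂ joinSep (small⇒f≡ x-small) (small⇒f≡ y-small) ⟩
    (proj₁ (f x) ∪ proj₁ (f y) , ⊤ ∩ ⊤)       ≡⟨ cong (proj₁ (f x) ∪ proj₁ (f y) ,_) (∩-idem ⊤) ⟩
    (proj₁ (f x) ∪ proj₁ (f y) , ⊤)           ∎)

  ∧-small : ∀ {x y} → IsSmall x → IsSmall y → IsSmall (x ∧ y)
  ∧-small {x} {y} x-small y-small = f≡⇒small (begin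
    f (x ∧ y)                                 ≡⟨ pres-∧ x y ⟩
    meetSep (f x) (f y)                       ≡⟨ cong₂ meetSep (small⇒f≡ x-small) (small⇒f≡ y-small) ⟩
    (proj₁ (f x) ∩ proj₁ (f y) , ⊤ ∪ ⊤)       ≡⟨ cong (proj₁ (f x) ∩ proj₁ (f y) ,_) (∪-idem ⊤) ⟩
    (proj₁ (f x) ∩ proj₁ (f y) , ⊤)           ∎)

  open SmallSublattice ∨-small ∧-small

  small-preimage : ∀ A → ∃[ x ] (f x ≡ (A , ⊤))
  small-preimage A = onto (A , ⊤) (∪-zeroʳ A , λ _ _ _ u∉⊤ _ _ _ → u∉⊤ ∈⊤)

  embed : Subset V → Small
  embed A = proj₁ (small-preimage A) , f≡⇒small (proj₂ (small-preimage A))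

  f-embed : ∀ A → f (proj₁ (embed A)) ≡ (A , ⊤)
  f-embed A = proj₂ (small-preimage A)

  ⊤ₛ ⊥ₛ : Small
  ⊤ₛ = embed ⊤
  ⊥ₛ = embed ⊥

  ¬ₛ_ : Op₁ Small
  ¬ₛ (x , _) = embed (∁ (proj₁ (f x)))

  maximum : Maximum _≤S_ ⊤ₛ
  maximum (x , x-small) = f∨≡⇒≤ (begin
    joinSep (f x) (f (proj₁ ⊤ₛ))              ≡⟨ cong₂ joinSep (small⇒f≡ x-small) (f-embed ⊤) ⟩
    (proj₁ (f x) ∪ ⊤ , ⊤ ∩ ⊤)                 ≡⟨ cong₂ _,_ (∪-zeroʳ _) (∩-idem ⊤) ⟩
    (⊤ , ⊤)                                   ≡⟨ ≡.sym (f-embed ⊤) ⟩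
    f (proj₁ ⊤ₛ)                              ∎)

  minimum : Minimum _≤S_ ⊥ₛ
  minimum (y , _) = f∨≡⇒≤ (begin
    joinSep (f (proj₁ ⊥ₛ)) (f y)              ≡⟨ cong (λ s → joinSep s (f y)) (f-embed ⊥) ⟩
    (⊥ ∪ proj₁ (f y) , ⊤ ∩ proj₂ (f y))       ≡⟨ cong₂ _,_ (∪-identityˡ _) (∩-identityˡ _) ⟩
    f y                                       ∎)

  x∧¬x≤⊥ₛ : ∀ x → (x ∧ₛ (¬ₛ x)) ≤S ⊥ₛ
  x∧¬x≤⊥ₛ x@(x₀ , x-small) = reflexive (injective (begin
    f (x₀ ∧ proj₁ (¬ₛ x))                     ≡⟨ pres-∧ x₀ _ ⟩
    meetSep (f x₀) (f (proj₁ (¬ₛ x)))         ≡⟨ cong₂ meetSep (small⇒f≡ x-small) (f-embed _) ⟩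
    (proj₁ (f x₀) ∩ ∁ (proj₁ (f x₀)) , ⊤ ∪ ⊤) ≡⟨ cong₂ _,_ (∩-inverseʳ _) (∪-idem ⊤) ⟩
    (⊥ , ⊤)                                   ≡⟨ ≡.sym (f-embed ⊥) ⟩
    f (proj₁ ⊥ₛ)                              ∎))

  ⊤ₛ≤x∨¬x : ∀ x → ⊤ₛ ≤S (x ∨ₛ (¬ₛ x))
  ⊤ₛ≤x∨¬x x@(x₀ , x-small) = reflexive (injective (begin
    f (proj₁ ⊤ₛ)                              ≡⟨ f-embed ⊤ ⟩
    (⊤ , ⊤)                                   ≡⟨ ≡.sym (cong₂ _,_ (∪-inverseʳ _) (∩-idem ⊤)) ⟩
    (proj₁ (f x₀) ∪ ∁ (proj₁ (f x₀)) , ⊤ ∩ ⊤) ≡⟨ ≡.sym (cong₂ joinSep (small⇒f≡ x-small) (f-embed _)) ⟩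
    joinSep (f x₀) (f (proj₁ (¬ₛ x)))         ≡⟨ ≡.sym (pres-∨ x₀ _) ⟩
    f (x₀ ∨ proj₁ (¬ₛ x))                     ∎))

  ⊤ₛ-degenerate : IsDegenerate (proj₁ ⊤ₛ)
  ⊤ₛ-degenerate = injective (begin
    f (proj₁ ⊤ₛ)                              ≡⟨ f-embed ⊤ ⟩
    swapSep (⊤ , ⊤)                           ≡⟨ cong swapSep (≡.sym (f-embed ⊤)) ⟩
    swapSep (f (proj₁ ⊤ₛ))                    ≡⟨ ≡.sym (pres-* _) ⟩
    f (proj₁ ⊤ₛ *)                            ∎)

  smallBoolean : SmallBooleanWithDegenerateTop U
  smallBoolean = _∨ₛ_ , _∧ₛ_ , ¬ₛ_ , ⊤ₛ , ⊥ₛ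
               , complemented⇒isBooleanAlgebra (isDistributiveLattice distributive)
                   maximum minimum x∧¬x≤⊥ₛ ⊤ₛ≤x∨¬x
               , ⊤ₛ-degenerate

module SmallBoolean (U : Universe) (distributive : Distributive U)
  {_∨ₛ_ _∧ₛ_ : Op₂ (Universe.Small U)} {¬ₛ_ : Op₁ (Universe.Small U)} {⊤ₛ ⊥ₛ : Universe.Small U}
  (isBooleanAlgebra : IsBooleanAlgebra (Universe._≈S_ U) (Universe._≤S_ U) _∨ₛ_ _∧ₛ_ ¬ₛ_ ⊤ₛ ⊥ₛ)
  (⊤ₛ-degenerate : Universe.IsDegenerate U (proj₁ ⊤ₛ)) where

  open UniverseProperties U
  private
    module B = IsBooleanAlgebra isBooleanAlgebra

  δ 𝟘 : Carrier
  δ = proj₁ ⊤ₛ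
  𝟘 = proj₁ ⊥ₛ

  small⇒≤δ : ∀ {x} → IsSmall x → x ≤ δ
  small⇒≤δ x-small = B.maximum (_ , x-small)

  ≤δ⇒δ≤* : ∀ {x} → x ≤ δ → δ ≤ x *
  ≤δ⇒δ≤* {x} x≤δ = subst (_≤ x *) (≡.sym ⊤ₛ-degenerate) (*-antitone x≤δ)

  ≤δ⇒small : ∀ {x} → x ≤ δ → IsSmall x
  ≤δ⇒small x≤δ = ≤-trans x≤δ (≤δ⇒δ≤* x≤δ)

  𝟘-least : ∀ x → 𝟘 ≤ x
  𝟘-least x = ≤-trans (B.minimum (x ∧ 𝟘 , x∧𝟘-small)) (x∧y≤x x 𝟘)
    where
      x∧𝟘-small : IsSmall (x ∧ 𝟘)
      x∧𝟘-small = ≤δ⇒small (≤-trans (x∧y≤y x 𝟘) (small⇒≤δ (proj₂ ⊥ₛ)))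

  open Joins U 𝟘 𝟘-least public

  ∁δ : ∀ {y} → y ≤ δ → Carrier
  ∁δ y≤δ = proj₁ (¬ₛ (_ , ≤δ⇒small y≤δ))

  ∁δ≤δ : ∀ {y} (y≤δ : y ≤ δ) → ∁δ y≤δ ≤ δ
  ∁δ≤δ y≤δ = B.maximum (¬ₛ (_ , ≤δ⇒small y≤δ))

  ∁δ-∧ : ∀ {y} (y≤δ : y ≤ δ) → (∁δ y≤δ ∧ y) ≤ 𝟘
  ∁δ-∧ {y} y≤δ = B.trans {i = c∧y} {j = (¬ₛ y′) ∧ₛ y′} {k = ⊥ₛ}
      (B.∧-greatest {x = c∧y} (x∧y≤x _ _) (x∧y≤y _ _))
      (B.transpose-∧ (B.x≤x∨y (¬ₛ y′) ⊥ₛ))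
    where
      y′ c∧y : Small
      y′  = y , ≤δ⇒small y≤δ
      c∧y = ∁δ y≤δ ∧ y , ≤δ⇒small (≤-trans (x∧y≤y _ _) y≤δ)

  ∁δ-∨ : ∀ {y} (y≤δ : y ≤ δ) → δ ≤ (∁δ y≤δ ∨ y)
  ∁δ-∨ {y} y≤δ = B.trans {i = ⊤ₛ} {j = (¬ₛ y′) ∨ₛ y′} {k = c∨y}
      (B.transpose-⇨ (B.x∧y≤y ⊤ₛ y′))
      (B.∨-least {z = c∨y} (x≤x∨y _ _) (y≤x∨y _ _))
    where
      y′ c∨y : Small
      y′  = y , ≤δ⇒small y≤δ
      c∨y = ∁δ y≤δ ∨ y , ≤δ⇒small (∨-least (∁δ≤δ y≤δ) y≤δ)

  Atom : Pred Carrier 0ℓ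
  Atom a = a ≤ δ × a ≢ 𝟘 × (∀ b → b ≤ a → b ≡ 𝟘 ⊎ b ≡ a)

  atom≰𝟘 : ∀ {a} → Atom a → ¬ (a ≤ 𝟘)
  atom≰𝟘 (_ , a≢𝟘 , _) a≤𝟘 = a≢𝟘 (antisym a≤𝟘 (𝟘-least _))

  atom⇒joinPrime : ∀ {a} → Atom a → JoinPrime a
  atom⇒joinPrime {a} a-atom@(_ , _ , minimal) = atom≰𝟘 a-atom , prime
    where
      prime : ∀ x y → a ≤ (x ∨ y) → a ≤ x ⊎ a ≤ y
      prime x y a≤x∨y with minimal (a ∧ x) (x∧y≤x a x) | minimal (a ∧ y) (x∧y≤x a y)
      ... | inj₂ a∧x≡a | _          = inj₁ (subst (_≤ x) a∧x≡a (x∧y≤y a x))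
      ... | inj₁ _     | inj₂ a∧y≡a = inj₂ (subst (_≤ y) a∧y≡a (x∧y≤y a y))
      ... | inj₁ a∧x≡𝟘 | inj₁ a∧y≡𝟘 = ⊥-elim (atom≰𝟘 a-atom (begin
        a                   ≤⟨ ∧-greatest ≤-refl a≤x∨y ⟩
        a ∧ (x ∨ y)         ≈⟨ IsDistributiveLattice.∧-distribˡ-∨ distributive a x y ⟩
        (a ∧ x) ∨ (a ∧ y)   ≈⟨ cong₂ _∨_ a∧x≡𝟘 a∧y≡𝟘 ⟩
        𝟘 ∨ 𝟘               ≤⟨ ∨-least ≤-refl ≤-refl ⟩
        𝟘                   ∎))
        where open ≤-Reasoning poset

  atom-≤⇒≡ : ∀ {a b} → Atom a → Atom b → a ≤ b → a ≡ b
  atom-≤⇒≡ (_ , a≢𝟘 , _) (_ , _ , minimal) a≤b with minimal _ a≤b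
  ... | inj₁ a≡𝟘 = ⊥-elim (a≢𝟘 a≡𝟘)
  ... | inj₂ a≡b = a≡b

  atom≤* : ∀ {a y} → Atom a → y ≤ δ → a ≤ y *
  atom≤* (a≤δ , _) y≤δ = ≤-trans a≤δ (≤δ⇒δ≤* y≤δ)

  atom-≤⊎≤* : ∀ {a} → Atom a → ∀ x → a ≤ x ⊎ a ≤ x *
  atom-≤⊎≤* {a} a-atom x =
    [ inj₂ , inj₁ ∘ subst (a ≤_) (*-invol x) ]′ (proj₂ (atom⇒joinPrime a-atom) (x *) (x * *) a≤x*∨x**)
    where
      x∧x*-small : IsSmall (x ∧ x *)
      x∧x*-small = ≤-trans (x∧y≤y _ _) (*-antitone (x∧y≤x _ _))

      a≤x*∨x** : a ≤ (x * ∨ x * *)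
      a≤x*∨x** = subst (a ≤_) (*-∧ x (x *)) (atom≤* a-atom (small⇒≤δ x∧x*-small))

module AtomicRepresentation (U : Universe) (finite : Finite U) (distributive : Distributive U)
  {_∨ₛ_ _∧ₛ_ : Op₂ (Universe.Small U)} {¬ₛ_ : Op₁ (Universe.Small U)} {⊤ₛ ⊥ₛ : Universe.Small U}
  (isBooleanAlgebra : IsBooleanAlgebra (Universe._≈S_ U) (Universe._≤S_ U) _∨ₛ_ _∧ₛ_ ¬ₛ_ ⊤ₛ ⊥ₛ)
  (⊤ₛ-degenerate : Universe.IsDegenerate U (proj₁ ⊤ₛ)) where

  open UniverseProperties U
  open FiniteUniverse U finite
  open SmallBoolean U distributive isBooleanAlgebra ⊤ₛ-degenerate public
  open ≤-Reasoning poset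

  atom-below : ∀ {r} → r ≤ δ → r ≢ 𝟘 → ∃[ a ] (Atom a × a ≤ r)
  atom-below r≤δ r≢𝟘 =
    let a , a≤r , a≢𝟘 , minimal = minimal-below (λ b → ¬? (b ≟ 𝟘)) r≢𝟘 in
    a , (≤-trans a≤r r≤δ , a≢𝟘 , λ b b≤a → map₂ (λ b≢𝟘 → minimal b≢𝟘 b≤a) (toSum (b ≟ 𝟘))) , a≤r

  ≤δ-atomistic : ∀ {p q} → p ≤ δ → q ≤ δ → (∀ {a} → Atom a → a ≤ p → a ≤ q) → p ≤ q
  ≤δ-atomistic {p} {q} p≤δ q≤δ atoms⊆ with p ∧ ∁δ q≤δ ≟ 𝟘
  ... | yes p∧∁q≡𝟘 = begin
    p                          ≤⟨ ∧-greatest ≤-refl (≤-trans p≤δ (∁δ-∨ q≤δ)) ⟩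
    p ∧ (∁δ q≤δ ∨ q)           ≈⟨ IsDistributiveLattice.∧-distribˡ-∨ distributive p _ q ⟩
    (p ∧ ∁δ q≤δ) ∨ (p ∧ q)     ≤⟨ ∨-least (≤-trans (reflexive p∧∁q≡𝟘) (𝟘-least q)) (x∧y≤y p q) ⟩
    q                          ∎
  ... | no p∧∁q≢𝟘 =
    let a , a-atom , a≤p∧∁q = atom-below (≤-trans (x∧y≤x p _) p≤δ) p∧∁q≢𝟘
        a≤q = atoms⊆ a-atom (≤-trans a≤p∧∁q (x∧y≤x p _))
    in ⊥-elim (atom≰𝟘 a-atom (≤-trans (∧-greatest (≤-trans a≤p∧∁q (x∧y≤y p _)) a≤q) (∁δ-∧ q≤δ)))

  atoms-determine-≤ : ∀ {x y} → (∀ {a} → Atom a → a ≤ x → a ≤ y) →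
                      (∀ {a} → Atom a → a ≤ y * → a ≤ x *) → x ≤ y
  atoms-determine-≤ {x} {y} x⊆y y*⊆x* = begin
    x                    ≤⟨ ∧-greatest ≤-refl x≤y∨δ ⟩
    x ∧ (y ∨ δ)          ≈⟨ IsDistributiveLattice.∧-distribˡ-∨ distributive x y δ ⟩
    (x ∧ y) ∨ (x ∧ δ)    ≤⟨ ∨-least (x∧y≤y x y) (∧δ-≤ x⊆y) ⟩
    y                    ∎
    where
      ∧δ-≤ : ∀ {x y} → (∀ {a} → Atom a → a ≤ x → a ≤ y) → (x ∧ δ) ≤ y
      ∧δ-≤ {x} {y} x⊆y = ≤-trans
        (≤δ-atomistic (x∧y≤y x δ) (x∧y≤y y δ) λ a-atom a≤x∧δ →
          ∧-greatest (x⊆y a-atom (≤-trans a≤x∧δ (x∧y≤x x δ))) (proj₁ a-atom))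
        (x∧y≤x y δ)

      x≤y∨δ : x ≤ (y ∨ δ)
      x≤y∨δ = subst (x ≤_) (≡.trans (*-∧ (y *) δ) (cong₂ _∨_ (*-invol y) (≡.sym ⊤ₛ-degenerate)))
                           (≤*-swap (∧δ-≤ y*⊆x*))

  Atom? : Decidable Atom
  Atom? a = a ≤? δ ×-dec ¬? (a ≟ 𝟘) ×-dec ∀? (λ b → b ≤? a →-dec (b ≟ 𝟘 ⊎-dec b ≟ a))

  open Enumeration (enumerate Atom?) public
    renaming (size to m; element to atom; injective to atom-injective;
              sound to atom-isAtom; complete to atom-surjective)

  atomsBelow : Carrier → Subset m
  atomsBelow x = subset (λ v → atom v ≤? x)

  ∈atomsBelow⁺ : ∀ {v x} → atom v ≤ x → v ∈ atomsBelow x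
  ∈atomsBelow⁺ {x = x} = ∈-subset⁺ (λ v → atom v ≤? x)

  ∈atomsBelow⁻ : ∀ {v x} → v ∈ atomsBelow x → atom v ≤ x
  ∈atomsBelow⁻ {x = x} = ∈-subset⁻ (λ v → atom v ≤? x)

  atomsBelow-∨ : ∀ x y → atomsBelow (x ∨ y) ≡ atomsBelow x ∪ atomsBelow y
  atomsBelow-∨ x y = ⊆-antisym
    (λ {v} v∈ → x∈p∪q⁺ (Data.Sum.map ∈atomsBelow⁺ ∈atomsBelow⁺
      (proj₂ (atom⇒joinPrime (atom-isAtom v)) x y (∈atomsBelow⁻ v∈))))
    (λ v∈ → ∈atomsBelow⁺ ([ (λ v∈x → ≤-trans (∈atomsBelow⁻ v∈x) (x≤x∨y x y))
                         , (λ v∈y → ≤-trans (∈atomsBelow⁻ v∈y) (y≤x∨y x y)) ]′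
                         (x∈p∪q⁻ (atomsBelow x) (atomsBelow y) v∈)))

  atomsBelow-∧ : ∀ x y → atomsBelow (x ∧ y) ≡ atomsBelow x ∩ atomsBelow y
  atomsBelow-∧ x y = ⊆-antisym
    (λ v∈ → x∈p∩q⁺ ( ∈atomsBelow⁺ (≤-trans (∈atomsBelow⁻ v∈) (x∧y≤x x y))
                   , ∈atomsBelow⁺ (≤-trans (∈atomsBelow⁻ v∈) (x∧y≤y x y))))
    (λ v∈ → let v∈x , v∈y = x∈p∩q⁻ (atomsBelow x) (atomsBelow y) v∈ in
            ∈atomsBelow⁺ (∧-greatest (∈atomsBelow⁻ v∈x) (∈atomsBelow⁻ v∈y)))

  represent : Carrier → Sep m
  represent x = atomsBelow x , atomsBelow (x *)

  represent-* : ∀ x → represent (x *) ≡ swapSep (represent x)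
  represent-* x = cong (atomsBelow (x *) ,_) (cong atomsBelow (*-invol x))

  represent-∨ : ∀ x y → represent (x ∨ y) ≡ joinSep (represent x) (represent y)
  represent-∨ x y = cong₂ _,_ (atomsBelow-∨ x y)
                              (≡.trans (cong atomsBelow (*-∨ x y)) (atomsBelow-∧ (x *) (y *)))

  represent-∧ : ∀ x y → represent (x ∧ y) ≡ meetSep (represent x) (represent y)
  represent-∧ x y = cong₂ _,_ (atomsBelow-∧ x y)
                              (≡.trans (cong atomsBelow (*-∧ x y)) (atomsBelow-∨ (x *) (y *)))

  represent-injective : Injective _≡_ _≡_ represent
  represent-injective {x} {y} eq = antisym
    (atoms-determine-≤ (transfer (cong proj₁ eq)) (transfer (≡.sym (cong proj₂ eq))))
    (atoms-determine-≤ (transfer (≡.sym (cong proj₁ eq))) (transfer (cong proj₂ eq)))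
    where
      transfer : ∀ {x y} → atomsBelow x ≡ atomsBelow y → ∀ {a} → Atom a → a ≤ x → a ≤ y
      transfer eq a-atom a≤x with atom-surjective a-atom
      ... | v , refl = ∈atomsBelow⁻ (subst (v ∈_) eq (∈atomsBelow⁺ a≤x))

  Inside : Carrier → Carrier → Set
  Inside a x = a ≤ x × ¬ (a ≤ x *)

  Inside? : ∀ a x → Dec (Inside a x)
  Inside? a x = a ≤? x ×-dec ¬? (a ≤? x *)

  Separable : Fin m → Fin m → Set
  Separable u v = ∃[ x ] (Inside (atom u) x × Inside (atom v) (x *))

  separable? : ∀ u v → Dec (Separable u v)
  separable? u v = ∃? (λ x → Inside? (atom u) x ×-dec Inside? (atom v) (x *))

  separable-sym : ∀ {u v} → Separable u v → Separable v u
  separable-sym {u} (x , u-in-x , v-in-x*) =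
    x * , v-in-x* , subst (Inside (atom u)) (≡.sym (*-invol x)) u-in-x

  atomGraph : Graph
  atomGraph = record
    { m      = m
    ; Adj    = λ u v → u ≢ v × ¬ Separable u v
    ; sym    = λ (u≢v , ¬sep) → u≢v ∘ ≡.sym , ¬sep ∘ separable-sym
    ; irrefl = λ (u≢u , _) → u≢u refl }

  represent-into : ∀ x → InUG atomGraph (represent x)
  represent-into x = ⊆-antisym (λ _ → ∈⊤) (λ {v} _ → x∈p∪q⁺ (covers v)) , not-adjacent
    where
      covers : ∀ v → v ∈ atomsBelow x ⊎ v ∈ atomsBelow (x *)
      covers v = Data.Sum.map ∈atomsBelow⁺ ∈atomsBelow⁺ (atom-≤⊎≤* (atom-isAtom v) x)

      not-adjacent : ∀ u v → u ∈ atomsBelow x → u ∉ atomsBelow (x *) →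
                     v ∈ atomsBelow (x *) → v ∉ atomsBelow x → ¬ Graph.Adj atomGraph u v
      not-adjacent u v u∈x u∉x* v∈x* v∉x (_ , ¬sep) = ¬sep
        ( x
        , (∈atomsBelow⁻ u∈x , u∉x* ∘ ∈atomsBelow⁺)
        , (∈atomsBelow⁻ v∈x* , v∉x ∘ ∈atomsBelow⁺ ∘ subst (atom v ≤_) (*-invol x)) )

  separator : ∀ {u v} → Dec (Separable u v) → Carrier
  separator (yes (x , _)) = x
  separator (no _)        = 𝟙

  inside-separator : ∀ {u v} (sep? : Dec (Separable u v)) → Inside (atom u) (separator sep?)
  inside-separator (yes (_ , u-in-x , _)) = u-in-x
  inside-separator {u} (no _) =
    𝟙-greatest (atom u) , λ u≤𝟙* → atom≰𝟘 (atom-isAtom u) (subst (atom u ≤_) (*-invol 𝟘) u≤𝟙*)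

  outside-separator : ∀ {u v} (sep? : Dec (Separable u v)) → Separable u v →
                      atom v ≤ separator sep? * × ¬ (atom v ≤ separator sep?)
  outside-separator {v = v} (yes (x , _ , v≤x* , v≰x**)) _ =
    v≤x* , v≰x** ∘ subst (atom v ≤_) (≡.sym (*-invol x))
  outside-separator (no ¬sep) sep = ⊥-elim (¬sep sep)

  -- The preimage of (A , B) is X = (Z ∨ P) ∧ P*. Here Z joins, over u ∈ A ∖ B,
  -- the meets Y u, over all v separable from u, of a separation with u inside
  -- and v inside its inverse; so the atoms below Z lie in A and those below Z*
  -- lie in B. P joins the atoms of A ∩ B, and as P ≤ δ every atom lies below P*.
  module Preimage (A B : Subset m) (AB∈UG : InUG atomGraph (A , B)) where

    ∉A⇒∈B : ∀ {w} → w ∉ A → w ∈ B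
    ∉A⇒∈B {w} w∉A = [ ⊥-elim ∘ w∉A , (λ w∈B → w∈B) ]′
                       (x∈p∪q⁻ A B (subst (w ∈_) (≡.sym (proj₁ AB∈UG)) ∈⊤))

    ∉B⇒∈A : ∀ {w} → w ∉ B → w ∈ A
    ∉B⇒∈A {w} w∉B = [ (λ w∈A → w∈A) , ⊥-elim ∘ w∉B ]′
                       (x∈p∪q⁻ A B (subst (w ∈_) (≡.sym (proj₁ AB∈UG)) ∈⊤))

    separable : ∀ {u v} → u ∈ A → u ∉ B → v ∈ B → v ∉ A → Separable u v
    separable {u} {v} u∈A u∉B v∈B v∉A = decidable-stable (separable? u v) λ ¬sep →
      proj₂ AB∈UG u v u∈A u∉B v∈B v∉A ((λ { refl → u∉B v∈B }) , ¬sep)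

    A∖B? : Decidable (λ w → w ∈ A × w ∉ B)
    A∖B? w = w ∈? A ×-dec ¬? (w ∈? B)

    A∩B? : Decidable (λ w → w ∈ A × w ∈ B)
    A∩B? w = w ∈? A ×-dec w ∈? B

    Y : Fin m → Carrier
    Y u = ⋀ (λ v → separator (separable? u v))

    Z P X : Carrier
    Z = ⋁[ A∖B? ] Y
    P = ⋁[ A∩B? ] atom
    X = (Z ∨ P) ∧ P *

    atom-prime : ∀ v → JoinPrime (atom v)
    atom-prime v = atom⇒joinPrime (atom-isAtom v)

    ≤P* : ∀ w → atom w ≤ P *
    ≤P* w = atom≤* (atom-isAtom w) (⋁[]-least A∩B? atom λ v _ → proj₁ (atom-isAtom v))

    ≤P⇒∈A∩B : ∀ {w} → atom w ≤ P → w ∈ A × w ∈ B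
    ≤P⇒∈A∩B {w} w≤P with ⋁[]-prime A∩B? atom (atom-prime w) w≤P
    ... | v , v∈A∩B , w≤v
      rewrite atom-injective (atom-≤⇒≡ (atom-isAtom w) (atom-isAtom v) w≤v) = v∈A∩B

    ∈A∖B⇒≤Z : ∀ {u} → u ∈ A → u ∉ B → atom u ≤ Z
    ∈A∖B⇒≤Z {u} u∈A u∉B = ≤-trans (⋀-greatest _ λ v → proj₁ (inside-separator (separable? u v)))
                                   (⋁[]-upper A∖B? Y (u∈A , u∉B))

    ≤Z⇒∈A : ∀ {v} → atom v ≤ Z → v ∈ A
    ≤Z⇒∈A {v} v≤Z = decidable-stable (v ∈? A) λ v∉A →
      let u , (u∈A , u∉B) , v≤Yu = ⋁[]-prime A∖B? Y (atom-prime v) v≤Z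
          sep = separable u∈A u∉B (∉A⇒∈B v∉A) v∉A
      in proj₂ (outside-separator (separable? u v) sep) (≤-trans v≤Yu (⋀-lower _ v))

    ∈B∖A⇒≤Z* : ∀ {v} → v ∈ B → v ∉ A → atom v ≤ Z *
    ∈B∖A⇒≤Z* {v} v∈B v∉A = ≤*-swap (⋁[]-least A∖B? Y λ u (u∈A , u∉B) →
      ≤-trans (⋀-lower _ v)
              (≤*-swap (proj₁ (outside-separator (separable? u v) (separable u∈A u∉B v∈B v∉A)))))

    ≤Z*⇒∈B : ∀ {v} → atom v ≤ Z * → v ∈ B
    ≤Z*⇒∈B {v} v≤Z* = decidable-stable (v ∈? B) λ v∉B →
      let v≤Yv* = ≤-trans v≤Z* (*-antitone (⋁[]-upper A∖B? Y (∉B⇒∈A v∉B , v∉B)))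
          i , v≤sep* = ⋁-prime _ (atom-prime v) (subst (atom v ≤_) (*-⋀ (λ i → separator (separable? v i))) v≤Yv*)
      in proj₂ (inside-separator (separable? v i)) v≤sep*

    X*≡ : X * ≡ (Z * ∧ P *) ∨ P
    X*≡ = ≡.trans (*-∧ (Z ∨ P) (P *)) (cong₂ _∨_ (*-∨ Z P) (*-invol P))

    atomsBelow-X : atomsBelow X ≡ A
    atomsBelow-X = ⊆-antisym (λ v∈X → ⊆A (∈atomsBelow⁻ v∈X)) (λ v∈A → ∈atomsBelow⁺ (A⊆ v∈A))
      where
        ⊆A : ∀ {v} → atom v ≤ X → v ∈ A
        ⊆A {v} v≤X = [ ≤Z⇒∈A , proj₁ ∘ ≤P⇒∈A∩B ]′
                       (proj₂ (atom-prime v) Z P (≤-trans v≤X (x∧y≤x _ _)))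

        A⊆ : ∀ {v} → v ∈ A → atom v ≤ X
        A⊆ {v} v∈A with v ∈? B
        ... | yes v∈B = ∧-greatest (≤-trans (⋁[]-upper A∩B? atom (v∈A , v∈B)) (y≤x∨y Z P)) (≤P* v)
        ... | no v∉B  = ∧-greatest (≤-trans (∈A∖B⇒≤Z v∈A v∉B) (x≤x∨y Z P)) (≤P* v)

    atomsBelow-X* : atomsBelow (X *) ≡ B
    atomsBelow-X* = ⊆-antisym (λ v∈X* → ⊆B (∈atomsBelow⁻ v∈X*)) (λ v∈B → ∈atomsBelow⁺ (B⊆ v∈B))
      where
        ⊆B : ∀ {v} → atom v ≤ X * → v ∈ B
        ⊆B {v} v≤X* = [ (λ v≤Z*∧P* → ≤Z*⇒∈B (≤-trans v≤Z*∧P* (x∧y≤x _ _))) , proj₂ ∘ ≤P⇒∈A∩B ]′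
                        (proj₂ (atom-prime v) (Z * ∧ P *) P (subst (atom v ≤_) X*≡ v≤X*))

        B⊆ : ∀ {v} → v ∈ B → atom v ≤ X *
        B⊆ {v} v∈B = subst (atom v ≤_) (≡.sym X*≡) (case-A (v ∈? A))
          where
            case-A : Dec (v ∈ A) → atom v ≤ ((Z * ∧ P *) ∨ P)
            case-A (yes v∈A) = ≤-trans (⋁[]-upper A∩B? atom (v∈A , v∈B)) (y≤x∨y _ P)
            case-A (no v∉A)  = ≤-trans (∧-greatest (∈B∖A⇒≤Z* v∈B v∉A) (≤P* v)) (x≤x∨y _ P)

  represent-onto : ∀ s → InUG atomGraph s → ∃[ x ] (represent x ≡ s)
  represent-onto (A , B) AB∈UG = X , cong₂ _,_ atomsBelow-X atomsBelow-X*
    where open Preimage A B AB∈UG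

  graphic : HasGraphicImplementation U
  graphic = atomGraph , record
    { f         = represent
    ; injective = represent-injective
    ; into      = represent-into
    ; onto      = represent-onto
    ; pres-*    = represent-*
    ; pres-∨    = represent-∨
    ; pres-∧    = represent-∧ }

theorem4p2 : (U : Universe) → Finite U →
    HasGraphicImplementation U ⇔ (Distributive U × SmallBooleanWithDegenerateTop U)
theorem4p2 U finite = mk⇔
  (λ (G , iso) → let open GraphicUniverse U G iso in distributive , smallBoolean)
  (λ (distributive , _ , _ , _ , _ , _ , isBooleanAlgebra , ⊤ₛ-degenerate) →
     AtomicRepresentation.graphic U finite distributive isBooleanAlgebra ⊤ₛ-degenerate)
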